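{- Let $w \in W$ and $m \in \{1, \ldots, n\}$, and let $a_{1} < \cdots < a_{s}$ ($s\ge1$) be elements of $\{ k \in \{1,\dots, m-1\} \mid w \xrightarrow{(k, m)} ws_{(k, m)} \text{ is an edge of } \mathrm{QBG}(W)\}$, so that $w = y_{0} \xrightarrow{(a_{1}, m)} y_{1} \xrightarrow{(a_{2}, m)} \cdots \xrightarrow{(a_{s}, m)} y_{s}$ (with $y_t=y_{t-1}s_{(a_t,m)}$) is a directed path in $\mathrm{QBG}(W)$. Let $c < a_{1}$ be such that $y_{s} \xrightarrow{(c, a_{1})} y_{s}s_{(c, a_{1})}$ is an edge of $\mathrm{QBG}(W)$ and $w \xrightarrow{(c, m)} ws_{(c, m)}$ is not an edge of $\mathrm{QBG}(W)$. Then every $p < a_{1}$ such that $w \xrightarrow{(p, m)} ws_{(p, m)}$ is an edge of $\mathrm{QBG}(W)$ satisfies $p < c$.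
   Context: $W$ is the Weyl group of type $C_n$ with length function $\ell$; positive roots $\Delta^+=\{\varepsilon_i-\varepsilon_j,\varepsilon_i+\varepsilon_j\ (1\le i<j\le n),\ 2\varepsilon_k\}$ in $\bigoplus\mathbb Z\varepsilon_k$, $\alpha^\vee$ the coroot, $\rho$ half the sum of positive roots, $s_\alpha$ the reflection in $\alpha$. For $1\le i<j\le n$, $(i,j):=\varepsilon_i-\varepsilon_j$. The quantum Bruhat graph $\mathrm{QBG}(W)$ has vertex set $W$ and an edge $x\xrightarrow{\alpha}xs_\alpha$ ($\alpha\in\Delta^+$) iff $\ell(xs_\alpha)=\ell(x)+1$ or $\ell(xs_\alpha)=\ell(x)-2\langle\rho,\alpha^\vee\rangle+1$. -}

module Defs where

open import Data.Nat using (ℕ; zero; suc)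
import Data.Nat as ℕ
open import Data.Bool using (Bool; true; false; _xor_; _∨_; if_then_else_)
open import Data.Fin using (Fin; toℕ; _<_; _≟_)
open import Data.Fin.Permutation using (Permutation′; _⟨$⟩ʳ_; _⟨$⟩ˡ_; _∘ₚ_; transpose)
import Data.Fin.Permutation as P
open import Data.Integer using (ℤ; +_; -[1+_]; -_; _+_; _*_; _-_; 0ℤ; 1ℤ)
open import Data.List using (List; []; _∷_; foldr; allFin; map; concatMap; _++_)
open import Data.Product using (_×_; _,_)
open import Data.Sum using (_⊎_)
open import Relation.Binary.PropositionalEquality using (_≡_)
open import Relation.Nullary.Decidable using (⌊_⌋)

-- Vectors in ⊕_k ℤ ε_k (coordinates indexed 0..n-1; index k stands for k+1).
Vect : ℕ → Set
Vect n = Fin n → ℤ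

ε : ∀ {n} → Fin n → Vect n
ε k p = if ⌊ p ≟ k ⌋ then 1ℤ else 0ℤ

_⊕_ : ∀ {n} → Vect n → Vect n → Vect n
(u ⊕ v) p = u p + v p

_⊖_ : ∀ {n} → Vect n → Vect n → Vect n
(u ⊖ v) p = u p - v p

Σℤ : ∀ {n} → (Fin n → ℤ) → ℤ
Σℤ {n} f = foldr (λ k acc → f k + acc) 0ℤ (allFin n)

⟨_,_⟩ : ∀ {n} → Vect n → Vect n → ℤ
⟨ u , v ⟩ = Σℤ (λ k → u k * v k)

-- Weyl group of type C_n realised as the group of signed permutations:
-- w ε_k = (-1)^(neg k) ε_(perm k).
record W (n : ℕ) : Set where
  constructor mkW
  field
    perm : Permutation′ n
    neg  : Fin n → Bool
open W public

sgn : Bool → ℤ → ℤ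
sgn true  z = - z
sgn false z = z

act : ∀ {n} → W n → Vect n → Vect n
act w v p = sgn (neg w (perm w ⟨$⟩ˡ p)) (v (perm w ⟨$⟩ˡ p))

-- product x y (first apply y, then x)
_·_ : ∀ {n} → W n → W n → W n
x · y = mkW (perm y ∘ₚ perm x) (λ k → neg y k xor neg x (perm y ⟨$⟩ʳ k))

data PosRoot (n : ℕ) : Set where
  minus : (i j : Fin n) → i < j → PosRoot n
  plus  : (i j : Fin n) → i < j → PosRoot n
  long  : (k : Fin n) → PosRoot n

⦅_,_⦆ : ∀ {n} (i j : Fin n) → i < j → PosRoot n
⦅ i , j ⦆ = minus i j

vec : ∀ {n} → PosRoot n → Vect n
vec (minus i j _) = ε i ⊖ ε j
vec (plus i j _)  = ε i ⊕ ε j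
vec (long k)      = ε k ⊕ ε k

-- coroot α^∨ = 2α/(α,α), identified with a vector via the standard form
coroot : ∀ {n} → PosRoot n → Vect n
coroot (minus i j _) = ε i ⊖ ε j
coroot (plus i j _)  = ε i ⊕ ε j
coroot (long k)      = ε k

-- ρ = half the sum of positive roots = Σ_k (n - k + 1) ε_k (1-indexed k)
ρ : ∀ {n} → Vect n
ρ {n} k = + (n ℕ.∸ toℕ k)

-- reflection s_α as a signed permutation (s_α v = v - ⟨v,α^∨⟩ α)
sᵣ : ∀ {n} → PosRoot n → W n
sᵣ (minus i j _) = mkW (transpose i j) (λ _ → false)
sᵣ (plus i j _)  = mkW (transpose i j) (λ k → ⌊ k ≟ i ⌋ ∨ ⌊ k ≟ j ⌋)
sᵣ (long k)      = mkW P.id (λ p → ⌊ p ≟ k ⌋)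

firstNeg : List ℤ → Bool
firstNeg [] = false
firstNeg (+ zero ∷ zs) = firstNeg zs
firstNeg (+ suc _ ∷ _) = false
firstNeg (-[1+ _ ] ∷ _) = true

isNeg : ∀ {n} → Vect n → Bool
isNeg {n} v = firstNeg (map v (allFin n))

count : List Bool → ℕ
count = foldr (λ b acc → if b then suc acc else acc) 0

posRootVecs : (n : ℕ) → List (Vect n)
posRootVecs n =
  concatMap (λ i → concatMap (λ j →
     if ⌊ toℕ i ℕ.<? toℕ j ⌋ then (ε i ⊖ ε j) ∷ (ε i ⊕ ε j) ∷ [] else [])
     (allFin n)) (allFin n)
  ++ map (λ k → ε k ⊕ ε k) (allFin n)

ℓ : ∀ {n} → W n → ℕ
ℓ {n} w = count (map (λ β → isNeg (act w β)) (posRootVecs n))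

QBGEdge : ∀ {n} → W n → PosRoot n → Set
QBGEdge x α =
  (ℓ (x · sᵣ α) ≡ suc (ℓ x)) ⊎
  (+ ℓ (x · sᵣ α) ≡ + ℓ x - + 2 * ⟨ ρ , coroot α ⟩ + 1ℤ)

_⋆_ : ∀ {n} → W n → List (PosRoot n) → W n
x ⋆ [] = x
x ⋆ (α ∷ αs) = (x · sᵣ α) ⋆ αs

-- Write K = window w for the sequence i ↦ ⟨w ε_i, ρ⟩ of distinct nonzero integers. Counting the
-- positive roots sent to negative ones gives
--   ℓ(w) = #{i<j : K i < K j} + #{i<j : K i + K j < 0} + #{k : w ε_k < 0},
-- and right multiplication by s_(a,b) merely swaps K a and K b, which leaves the last two counts
-- unchanged. As in type A it follows that w → w s_(a,b) is an edge iff either K b < K a and no K q with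
-- a < q < b lies between them (a Bruhat edge), or K a < K b and every such K q lies between them (a
-- quantum edge), since ⟨ρ, (a,b)^∨⟩ = b - a. Along the path y₀ → ⋯ → y_s the window is unchanged below
-- a₁ and takes the value K m at a₁. Comparing the two kinds of edges (c, a₁) out of y_s and (p, m) out
-- of w then produces an edge (c, m) out of w whenever c < p.

module Submission where

open import Defs
open import Data.Nat as ℕ using (ℕ; zero; suc)
import Data.Nat.Properties as NP
open import Data.Fin as F using (Fin; zero; suc; toℕ; _<_)
import Data.Fin.Properties as FP
open import Data.Fin.Properties using (<-trans)
open import Data.Fin.Permutation using (_⟨$⟩ʳ_; _⟨$⟩ˡ_; inverseˡ; inverseʳ)
import Data.Fin.Permutation as Perm
import Data.Fin.Permutation.Components as PC
open import Data.Integer as ℤ using (ℤ; +_; -[1+_]; 0ℤ; 1ℤ; _+_; _-_; -_; _*_)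
import Data.Integer.Properties as ZP
open import Data.Integer.Tactic.RingSolver using (solve-∀)
open import Algebra.Properties.Semiring.Sum ZP.+-*-semiring
  using (sum; sum-cong-≗; sum-replicate-zero; ∑-distrib-+; ∑-permute; *-distribˡ-sum)
open import Data.Bool using (Bool; true; false; not; if_then_else_; _∧_)
open import Data.List using (List; []; _∷_; _++_; foldr; tabulate; map; concatMap; allFin)
open import Data.List.Properties using (map-++; map-tabulate)
open import Data.Product using (_×_; _,_; proj₁; proj₂)
open import Data.Sum using (_⊎_; inj₁; inj₂)
open import Data.Empty using (⊥-elim)
open import Relation.Binary.PropositionalEquality
open import Relation.Binary.Definitions using (tri<; tri≈; tri>)
open import Relation.Nullary using (¬_; Dec; yes; no)
open import Relation.Nullary.Decidable using (⌊_⌋; ⌊⌋-map′; T?; isYes≗does; dec-true; dec-false)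

indicator : Bool → ℤ
indicator b = if b then 1ℤ else 0ℤ

sum-zero : ∀ {n} {f : Fin n → ℤ} → (∀ k → f k ≡ 0ℤ) → sum f ≡ 0ℤ
sum-zero {n} f≡0 = trans (sum-cong-≗ f≡0) (sum-replicate-zero n)

∑-distrib-neg : ∀ {n} (f : Fin n → ℤ) → sum (λ k → - f k) ≡ - sum f
∑-distrib-neg {zero}  f = refl
∑-distrib-neg {suc n} f =
  trans (cong (_+_ (- f zero)) (∑-distrib-neg (λ k → f (suc k))))
        (sym (ZP.neg-distrib-+ (f zero) _))

∑-distrib-- : ∀ {n} (f g : Fin n → ℤ) → sum (λ k → f k - g k) ≡ sum f - sum g
∑-distrib-- f g = trans (∑-distrib-+ f (λ k → - g k)) (cong (_+_ (sum f)) (∑-distrib-neg g))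

suc-≢ : ∀ {n} {k a : Fin n} → k ≢ a → Fin.suc k ≢ suc a
suc-≢ k≢a sk≡sa = k≢a (FP.suc-injective sk≡sa)

sum-single : ∀ {n} (f : Fin n → ℤ) (a : Fin n) →
             (∀ k → k ≢ a → f k ≡ 0ℤ) → sum f ≡ f a
sum-single {suc n} f zero    f≡0 =
  trans (cong (_+_ (f zero)) (sum-zero (λ k → f≡0 (suc k) (λ ())))) (ZP.+-identityʳ (f zero))
sum-single {suc n} f (suc a) f≡0 =
  trans (cong₂ _+_ (f≡0 zero (λ ()))
                   (sum-single (λ k → f (suc k)) a (λ k k≢a → f≡0 (suc k) (suc-≢ k≢a))))
        (ZP.+-identityˡ (f (suc a)))

sum-pair : ∀ {n} (f : Fin n → ℤ) {a b : Fin n} → a ≢ b →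
           (∀ k → k ≢ a → k ≢ b → f k ≡ 0ℤ) → sum f ≡ f a + f b
sum-pair {suc n} f {zero}  {zero}  a≢b f≡0 = ⊥-elim (a≢b refl)
sum-pair {suc n} f {zero}  {suc b} a≢b f≡0 =
  cong (_+_ (f zero)) (sum-single (λ k → f (suc k)) b (λ k k≢b → f≡0 (suc k) (λ ()) (suc-≢ k≢b)))
sum-pair {suc n} f {suc a} {zero}  a≢b f≡0 =
  trans (cong (_+_ (f zero)) (sum-single (λ k → f (suc k)) a (λ k k≢a → f≡0 (suc k) (suc-≢ k≢a) (λ ()))))
        (ZP.+-comm (f zero) (f (suc a)))
sum-pair {suc n} f {suc a} {suc b} a≢b f≡0 =
  trans (cong₂ _+_ (f≡0 zero (λ ()) (λ ()))
                   (sum-pair (λ k → f (suc k)) (λ e → a≢b (cong suc e))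
                     (λ k k≢a k≢b → f≡0 (suc k) (suc-≢ k≢a) (suc-≢ k≢b))))
        (ZP.+-identityˡ _)

sum-split-pair : ∀ {n} (f g : Fin n → ℤ) {a b : Fin n} → a ≢ b →
                 (∀ k → k ≢ a → k ≢ b → f k ≡ g k) → g a ≡ 0ℤ → g b ≡ 0ℤ →
                 sum f ≡ sum g + (f a + f b)
sum-split-pair f g {a} {b} a≢b f≡g ga≡0 gb≡0 = begin
  sum f                                ≡⟨ x≡y+[x-y] (sum f) (sum g) ⟩
  sum g + (sum f - sum g)              ≡⟨ cong (_+_ (sum g)) (sym (∑-distrib-- f g)) ⟩
  sum g + sum (λ k → f k - g k)
    ≡⟨ cong (_+_ (sum g)) (sum-pair (λ k → f k - g k) a≢b difference-vanishes) ⟩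
  sum g + ((f a - g a) + (f b - g b))  ≡⟨ cong₂ (λ u v → sum g + ((f a - u) + (f b - v))) ga≡0 gb≡0 ⟩
  sum g + ((f a - 0ℤ) + (f b - 0ℤ))
    ≡⟨ cong₂ (λ u v → sum g + (u + v)) (ZP.+-identityʳ (f a)) (ZP.+-identityʳ (f b)) ⟩
  sum g + (f a + f b)                  ∎
  where
  open ≡-Reasoning
  x≡y+[x-y] : ∀ x y → x ≡ y + (x - y)
  x≡y+[x-y] = solve-∀
  difference-vanishes : ∀ k → k ≢ a → k ≢ b → f k - g k ≡ 0ℤ
  difference-vanishes k k≢a k≢b = trans (cong (_-_ (f k)) (sym (f≡g k k≢a k≢b))) (ZP.+-inverseʳ (f k))

sum-transpose : ∀ {n} (f : Fin n → ℤ) (a b : Fin n) → sum (λ k → f (PC.transpose a b k)) ≡ sum f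
sum-transpose f a b = sym (∑-permute f (Perm.transpose a b))

sum-nonneg : ∀ {n} (f : Fin n → ℤ) → (∀ k → 0ℤ ℤ.≤ f k) → 0ℤ ℤ.≤ sum f
sum-nonneg {zero}  f f≥0 = ℤ.+≤+ ℕ.z≤n
sum-nonneg {suc n} f f≥0 = ZP.+-mono-≤ (f≥0 zero) (sum-nonneg (λ k → f (suc k)) (λ k → f≥0 (suc k)))

nonneg-sum≡0⇒≡0 : ∀ {n} (f : Fin n → ℤ) → (∀ k → 0ℤ ℤ.≤ f k) → sum f ≡ 0ℤ →
                  ∀ k → f k ≡ 0ℤ
nonneg-sum≡0⇒≡0 {suc n} f f≥0 sum≡0 = λ where
    zero    → f₀≡0
    (suc k) → nonneg-sum≡0⇒≡0 (λ k → f (suc k)) (λ k → f≥0 (suc k)) rest≡0 k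
  where
  rest = sum (λ k → f (suc k))
  rest≥0 = sum-nonneg (λ k → f (suc k)) (λ k → f≥0 (suc k))
  f₀≡0 : f zero ≡ 0ℤ
  f₀≡0 = ZP.≤-antisym
    (subst (f zero ℤ.≤_) sum≡0
      (subst (ℤ._≤ f zero + rest) (ZP.+-identityʳ (f zero)) (ZP.+-monoʳ-≤ (f zero) rest≥0)))
    (f≥0 zero)
  rest≡0 : rest ≡ 0ℤ
  rest≡0 = trans (sym (ZP.+-identityˡ rest)) (trans (cong (_+ rest) (sym f₀≡0)) sum≡0)

Σℤ≡sum : ∀ {n} (f : Fin n → ℤ) → Σℤ f ≡ sum f
Σℤ≡sum {n} f = go (λ k → k)
  where
  go : ∀ {m} (g : Fin m → Fin n) → foldr (λ k acc → f k + acc) 0ℤ (tabulate g) ≡ sum (λ k → f (g k))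
  go {zero}  g = refl
  go {suc m} g = cong (_+_ (f (g zero))) (go (λ k → g (suc k)))

count-open-interval : ∀ n A B → B ℕ.≤ n →
  sum {n} (λ q → indicator ((A ℕ.<ᵇ toℕ q) ∧ (toℕ q ℕ.<ᵇ B))) ≡ + (B ℕ.∸ suc A)
count-open-interval zero    A       zero    _ = refl
count-open-interval (suc n) A       zero    _ =
  sum-zero {suc n} (λ q → cong indicator (∧-false (A ℕ.<ᵇ toℕ q)))
  where
  ∧-false : ∀ b → (b ∧ false) ≡ false
  ∧-false true  = refl
  ∧-false false = refl
count-open-interval (suc n) zero    (suc B) (ℕ.s≤s B≤n) =
  trans (ZP.+-identityˡ _) (count-prefix n B B≤n)
  where
  count-prefix : ∀ n B → B ℕ.≤ n → sum {n} (λ q → indicator (toℕ q ℕ.<ᵇ B)) ≡ + B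
  count-prefix n       zero    _ = sum-zero {n} (λ _ → refl)
  count-prefix (suc n) (suc B) (ℕ.s≤s B≤n) = cong (_+_ 1ℤ) (count-prefix n B B≤n)
count-open-interval (suc n) (suc A) (suc B) (ℕ.s≤s B≤n) =
  trans (ZP.+-identityˡ _) (count-open-interval n A B B≤n)

-- Negative vectors and the window of a signed permutation

⌊⌋-yes : ∀ {A : Set} (a? : Dec A) → A → ⌊ a? ⌋ ≡ true
⌊⌋-yes a? a = trans (isYes≗does a?) (dec-true a? a)

⌊⌋-no : ∀ {A : Set} (a? : Dec A) → ¬ A → ⌊ a? ⌋ ≡ false
⌊⌋-no a? ¬a = trans (isYes≗does a?) (dec-false a? ¬a)

transpose-at-i : ∀ {n} (i j : Fin n) → PC.transpose i j i ≡ j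
transpose-at-i i j rewrite dec-true (i F.≟ i) refl = refl

transpose-at-j : ∀ {n} (i j : Fin n) → PC.transpose i j j ≡ i
transpose-at-j i j with j F.≟ i
... | yes j≡i = j≡i
... | no _ rewrite dec-true (j F.≟ j) refl = refl

transpose-elsewhere : ∀ {n} (i j k : Fin n) → k ≢ i → k ≢ j → PC.transpose i j k ≡ k
transpose-elsewhere i j k k≢i k≢j rewrite dec-false (k F.≟ i) k≢i | dec-false (k F.≟ j) k≢j = refl

ε-diag : ∀ {n} (P : Fin n) → ε P P ≡ 1ℤ
ε-diag P rewrite ⌊⌋-yes (P F.≟ P) refl = refl

ε-offdiag : ∀ {n} (P p : Fin n) → p ≢ P → ε P p ≡ 0ℤ
ε-offdiag P p p≢P rewrite ⌊⌋-no (p F.≟ P) p≢P = refl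

sgn-0 : ∀ s → sgn s 0ℤ ≡ 0ℤ
sgn-0 true  = refl
sgn-0 false = refl

sgn-not : ∀ s z → sgn (not s) z ≡ - sgn s z
sgn-not true  z = sym (ZP.neg-involutive z)
sgn-not false z = refl

sgn-distrib-- : ∀ s a b → sgn s (a - b) ≡ sgn s a - sgn s b
sgn-distrib-- true  a b = lemma a b
  where
  lemma : ∀ a b → - (a - b) ≡ - a - - b
  lemma = solve-∀
sgn-distrib-- false a b = refl

isNeg-firstNonzero : ∀ {n} (v : Vect n) (p : Fin n) → v p ≢ 0ℤ →
                     (∀ q → toℕ q ℕ.< toℕ p → v q ≡ 0ℤ) → isNeg v ≡ firstNeg (v p ∷ [])
isNeg-firstNonzero v p vp≢0 v≡0 =
  trans (cong firstNeg (map-tabulate (λ k → k) v)) (go v p vp≢0 v≡0)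
  where
  go : ∀ {n} (v : Vect n) (p : Fin n) → v p ≢ 0ℤ → (∀ q → toℕ q ℕ.< toℕ p → v q ≡ 0ℤ) →
       firstNeg (tabulate v) ≡ firstNeg (v p ∷ [])
  go v zero vp≢0 _ with v zero
  ... | + zero    = ⊥-elim (vp≢0 refl)
  ... | + suc _   = refl
  ... | -[1+ _ ]  = refl
  go v (suc p) vp≢0 v≡0 rewrite v≡0 zero (ℕ.s≤s ℕ.z≤n) =
    go (λ k → v (suc k)) p vp≢0 (λ q q<p → v≡0 (suc q) (ℕ.s≤s q<p))

sgn-1≢0 : ∀ s → sgn s 1ℤ ≢ 0ℤ
sgn-1≢0 true  ()
sgn-1≢0 false ()

-sgn-1≢0 : ∀ s → - sgn s 1ℤ ≢ 0ℤ
-sgn-1≢0 true  ()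
-sgn-1≢0 false ()

firstNeg-sgn : ∀ s → firstNeg (sgn s 1ℤ ∷ []) ≡ s
firstNeg-sgn true  = refl
firstNeg-sgn false = refl

firstNeg-neg-sgn : ∀ s → firstNeg (- sgn s 1ℤ ∷ []) ≡ not s
firstNeg-neg-sgn true  = refl
firstNeg-neg-sgn false = refl

ρ-positive : ∀ {n} (P : Fin n) → 0ℤ ℤ.< ρ P
ρ-positive {n} P = ℤ.+<+ (NP.m<n⇒0<n∸m (FP.toℕ<n P))

ρ-decreasing : ∀ {n} {P Q : Fin n} → toℕ P ℕ.< toℕ Q → ρ Q ℤ.< ρ P
ρ-decreasing {n} {P} {Q} P<Q = ℤ.+<+ (NP.∸-monoʳ-< P<Q (NP.<⇒≤ (FP.toℕ<n Q)))

sgn-<-larger : ∀ s t {x y} → 0ℤ ℤ.< y → y ℤ.< x → ⌊ sgn s x ℤ.<? sgn t y ⌋ ≡ s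
sgn-<-larger false false 0<y y<x = ⌊⌋-no (_ ℤ.<? _) (ZP.<-asym y<x)
sgn-<-larger false true  0<y y<x =
  ⌊⌋-no (_ ℤ.<? _) (λ x<-y → ZP.<-asym (ZP.<-trans 0<y y<x) (ZP.<-trans x<-y (ZP.neg-mono-< 0<y)))
sgn-<-larger true  false 0<y y<x =
  ⌊⌋-yes (_ ℤ.<? _) (ZP.<-trans (ZP.neg-mono-< (ZP.<-trans 0<y y<x)) 0<y)
sgn-<-larger true  true  0<y y<x = ⌊⌋-yes (_ ℤ.<? _) (ZP.neg-mono-< y<x)

sgn-<-smaller : ∀ s t {x y} → 0ℤ ℤ.< y → y ℤ.< x → ⌊ sgn s y ℤ.<? sgn t x ⌋ ≡ not t
sgn-<-smaller false false 0<y y<x = ⌊⌋-yes (_ ℤ.<? _) y<x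
sgn-<-smaller false true  0<y y<x =
  ⌊⌋-no (_ ℤ.<? _) (λ y<-x → ZP.<-asym 0<y (ZP.<-trans y<-x (ZP.neg-mono-< (ZP.<-trans 0<y y<x))))
sgn-<-smaller true  false 0<y y<x =
  ⌊⌋-yes (_ ℤ.<? _) (ZP.<-trans (ZP.neg-mono-< 0<y) (ZP.<-trans 0<y y<x))
sgn-<-smaller true  true  0<y y<x = ⌊⌋-no (_ ℤ.<? _) (λ -y<-x → ZP.<-asym y<x (ZP.neg-cancel-< -y<-x))

signedPair-offsupport : ∀ {n} s t {P Q q : Fin n} → q ≢ P → q ≢ Q →
                        sgn s (ε P q) - sgn t (ε Q q) ≡ 0ℤ
signedPair-offsupport s t {P} {Q} {q} q≢P q≢Q
  rewrite ε-offdiag P q q≢P | ε-offdiag Q q q≢Q | sgn-0 s | sgn-0 t = refl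

-- A vector ±ε_P ∓ ε_Q is negative iff its pairing with ρ is, since ρ is positive and strictly decreasing.
isNeg-signedPair : ∀ {n} (v : Vect n) (s t : Bool) {P Q : Fin n} → P ≢ Q →
                   (∀ p → v p ≡ sgn s (ε P p) - sgn t (ε Q p)) →
                   isNeg v ≡ ⌊ sgn s (ρ P) ℤ.<? sgn t (ρ Q) ⌋
isNeg-signedPair v s t {P} {Q} P≢Q v≡ with NP.<-cmp (toℕ P) (toℕ Q)
... | tri≈ _ P≡Q _ = ⊥-elim (P≢Q (FP.toℕ-injective P≡Q))
... | tri< P<Q _ _ = begin
  isNeg v              ≡⟨ isNeg-firstNonzero v P (subst (_≢ 0ℤ) (sym vP) (sgn-1≢0 s))
                            (λ q q<P → vanish q (FP.<⇒≢ q<P) (FP.<⇒≢ (NP.<-trans q<P P<Q))) ⟩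
  firstNeg (v P ∷ [])  ≡⟨ cong (λ z → firstNeg (z ∷ [])) vP ⟩
  firstNeg (sgn s 1ℤ ∷ []) ≡⟨ firstNeg-sgn s ⟩
  s                    ≡⟨ sym (sgn-<-larger s t (ρ-positive Q) (ρ-decreasing P<Q)) ⟩
  ⌊ sgn s (ρ P) ℤ.<? sgn t (ρ Q) ⌋ ∎
  where
  open ≡-Reasoning
  vanish : ∀ q → q ≢ P → q ≢ Q → v q ≡ 0ℤ
  vanish q q≢P q≢Q = trans (v≡ q) (signedPair-offsupport s t q≢P q≢Q)
  vP : v P ≡ sgn s 1ℤ
  vP rewrite v≡ P | ε-diag P | ε-offdiag Q P P≢Q | sgn-0 t = ZP.+-identityʳ (sgn s 1ℤ)
... | tri> _ _ Q<P = begin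
  isNeg v              ≡⟨ isNeg-firstNonzero v Q (subst (_≢ 0ℤ) (sym vQ) (-sgn-1≢0 t))
                            (λ q q<Q → vanish q (FP.<⇒≢ (NP.<-trans q<Q Q<P)) (FP.<⇒≢ q<Q)) ⟩
  firstNeg (v Q ∷ [])  ≡⟨ cong (λ z → firstNeg (z ∷ [])) vQ ⟩
  firstNeg (- sgn t 1ℤ ∷ []) ≡⟨ firstNeg-neg-sgn t ⟩
  not t                ≡⟨ sym (sgn-<-smaller s t (ρ-positive P) (ρ-decreasing Q<P)) ⟩
  ⌊ sgn s (ρ P) ℤ.<? sgn t (ρ Q) ⌋ ∎
  where
  open ≡-Reasoning
  vanish : ∀ q → q ≢ P → q ≢ Q → v q ≡ 0ℤ
  vanish q q≢P q≢Q = trans (v≡ q) (signedPair-offsupport s t q≢P q≢Q)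
  vQ : v Q ≡ - sgn t 1ℤ
  vQ rewrite v≡ Q | ε-diag Q | ε-offdiag P Q (λ e → P≢Q (sym e)) | sgn-0 s = ZP.+-identityˡ (- sgn t 1ℤ)

isNeg-doubled : ∀ {n} (v : Vect n) (s : Bool) (P : Fin n) →
                (∀ p → v p ≡ sgn s (ε P p) + sgn s (ε P p)) → isNeg v ≡ s
isNeg-doubled v s P v≡ = begin
  isNeg v              ≡⟨ isNeg-firstNonzero v P (subst (_≢ 0ℤ) (sym vP) (nonzero s))
                            (λ q q<P → vanish q (FP.<⇒≢ q<P)) ⟩
  firstNeg (v P ∷ [])  ≡⟨ cong (λ z → firstNeg (z ∷ [])) vP ⟩
  firstNeg (sgn s 1ℤ + sgn s 1ℤ ∷ []) ≡⟨ firstNeg-doubled s ⟩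
  s ∎
  where
  open ≡-Reasoning
  vanish : ∀ q → q ≢ P → v q ≡ 0ℤ
  vanish q q≢P rewrite v≡ q | ε-offdiag P q q≢P | sgn-0 s = refl
  vP : v P ≡ sgn s 1ℤ + sgn s 1ℤ
  vP rewrite v≡ P | ε-diag P = refl
  nonzero : ∀ s → sgn s 1ℤ + sgn s 1ℤ ≢ 0ℤ
  nonzero true  ()
  nonzero false ()
  firstNeg-doubled : ∀ s → firstNeg (sgn s 1ℤ + sgn s 1ℤ ∷ []) ≡ s
  firstNeg-doubled true  = refl
  firstNeg-doubled false = refl

-- window x i is the pairing of x ε_i with ρ.
window : ∀ {n} → W n → Fin n → ℤ
window x i = sgn (neg x i) (ρ (perm x ⟨$⟩ʳ i))

perm-injective : ∀ {n} (x : W n) {i j : Fin n} → i ≢ j → perm x ⟨$⟩ʳ i ≢ perm x ⟨$⟩ʳ j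
perm-injective x {i} {j} i≢j πi≡πj =
  i≢j (trans (sym (inverseˡ (perm x))) (trans (cong (perm x ⟨$⟩ˡ_) πi≡πj) (inverseˡ (perm x))))

ρ-injective : ∀ {n} {P Q : Fin n} → ρ P ≡ ρ Q → P ≡ Q
ρ-injective {n} {P} {Q} ρP≡ρQ = FP.toℕ-injective
  (NP.∸-cancelˡ-≡ (NP.<⇒≤ (FP.toℕ<n P)) (NP.<⇒≤ (FP.toℕ<n Q)) (ZP.+-injective ρP≡ρQ))

sgn-injective : ∀ s t {a b} → 0ℤ ℤ.< a → 0ℤ ℤ.< b → sgn s a ≡ sgn t b → a ≡ b
sgn-injective false false 0<a 0<b a≡b   = a≡b
sgn-injective true  true  0<a 0<b -a≡-b = ZP.neg-injective -a≡-b
sgn-injective false true  0<a 0<b a≡-b  =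
  ⊥-elim (ZP.<-asym 0<a (subst (ℤ._< 0ℤ) (sym a≡-b) (ZP.neg-mono-< 0<b)))
sgn-injective true  false 0<a 0<b -a≡b  =
  ⊥-elim (ZP.<-asym 0<b (subst (ℤ._< 0ℤ) -a≡b (ZP.neg-mono-< 0<a)))

window-injective : ∀ {n} (x : W n) {i j : Fin n} → i ≢ j → window x i ≢ window x j
window-injective x {i} {j} i≢j wi≡wj = perm-injective x i≢j (ρ-injective
  (sgn-injective (neg x i) (neg x j) (ρ-positive (perm x ⟨$⟩ʳ i)) (ρ-positive (perm x ⟨$⟩ʳ j)) wi≡wj))

act-ε : ∀ {n} (x : W n) (i p : Fin n) → act x (ε i) p ≡ sgn (neg x i) (ε (perm x ⟨$⟩ʳ i) p)
act-ε x i p with p F.≟ perm x ⟨$⟩ʳ i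
... | yes refl rewrite inverseˡ (perm x) {i} | ε-diag i = refl
... | no p≢πi
  rewrite ε-offdiag i (perm x ⟨$⟩ˡ p)
            (λ e → p≢πi (trans (sym (inverseʳ (perm x))) (cong (perm x ⟨$⟩ʳ_) e)))
        | sgn-0 (neg x (perm x ⟨$⟩ˡ p)) | sgn-0 (neg x i) = refl

sgn-distrib-+ : ∀ s a b → sgn s (a + b) ≡ sgn s a + sgn s b
sgn-distrib-+ true  a b = ZP.neg-distrib-+ a b
sgn-distrib-+ false a b = refl

isNeg-act-minus : ∀ {n} (x : W n) {i j : Fin n} → i ≢ j →
                  isNeg (act x (ε i ⊖ ε j)) ≡ ⌊ window x i ℤ.<? window x j ⌋
isNeg-act-minus x {i} {j} i≢j = isNeg-signedPair _ (neg x i) (neg x j) (perm-injective x i≢j) λ p →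
  trans (sgn-distrib-- (neg x (perm x ⟨$⟩ˡ p)) _ _) (cong₂ _-_ (act-ε x i p) (act-ε x j p))

isNeg-act-plus : ∀ {n} (x : W n) {i j : Fin n} → i ≢ j →
                 isNeg (act x (ε i ⊕ ε j)) ≡ ⌊ window x i ℤ.<? - window x j ⌋
isNeg-act-plus x {i} {j} i≢j =
  trans (isNeg-signedPair _ (neg x i) (not (neg x j)) (perm-injective x i≢j) λ p →
           trans (sgn-distrib-+ (neg x (perm x ⟨$⟩ˡ p)) _ _)
                 (cong₂ _+_ (act-ε x i p) (trans (act-ε x j p) (sym (neg-sgn-not (neg x j) _)))))
        (cong (λ z → ⌊ window x i ℤ.<? z ⌋) (sgn-not (neg x j) _))
  where
  neg-sgn-not : ∀ s z → - sgn (not s) z ≡ sgn s z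
  neg-sgn-not true  z = refl
  neg-sgn-not false z = ZP.neg-involutive z

isNeg-act-long : ∀ {n} (x : W n) (k : Fin n) → isNeg (act x (ε k ⊕ ε k)) ≡ neg x k
isNeg-act-long x k = isNeg-doubled _ (neg x k) (perm x ⟨$⟩ʳ k) λ p →
  trans (sgn-distrib-+ (neg x (perm x ⟨$⟩ˡ p)) _ _) (cong₂ _+_ (act-ε x k p) (act-ε x k p))

-- The length counts ascents of the window

count-++ : ∀ bs cs → + count (bs ++ cs) ≡ + count bs + + count cs
count-++ []           cs = sym (ZP.+-identityˡ _)
count-++ (true  ∷ bs) cs = trans (cong (_+_ 1ℤ) (count-++ bs cs)) (sym (ZP.+-assoc 1ℤ (+ count bs) (+ count cs)))
count-++ (false ∷ bs) cs = count-++ bs cs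

count-concatMap : ∀ {A : Set} {m} (f : A → Bool) (B : Fin m → List A) {k} (g : Fin k → Fin m) →
                  + count (map f (concatMap B (tabulate g))) ≡ sum (λ t → + count (map f (B (g t))))
count-concatMap f B {zero}  g = refl
count-concatMap f B {suc k} g = begin
  + count (map f (B (g zero) ++ concatMap B (tabulate (λ t → g (suc t)))))
    ≡⟨ cong (λ bs → + count bs) (map-++ f (B (g zero)) _) ⟩
  + count (map f (B (g zero)) ++ map f (concatMap B (tabulate (λ t → g (suc t)))))
    ≡⟨ count-++ (map f (B (g zero))) _ ⟩
  + count (map f (B (g zero))) + + count (map f (concatMap B (tabulate (λ t → g (suc t)))))
    ≡⟨ cong (_+_ (+ count (map f (B (g zero))))) (count-concatMap f B (λ t → g (suc t))) ⟩
  sum (λ t → + count (map f (B (g t)))) ∎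
  where open ≡-Reasoning

count-map : ∀ {A : Set} {m} (f : A → Bool) (G : Fin m → A) →
            + count (map f (map G (allFin m))) ≡ sum (λ k → indicator (f (G k)))
count-map f G = go (λ k → k)
  where
  go : ∀ {k} (g : Fin k → _) → + count (map f (map G (tabulate g))) ≡ sum (λ t → indicator (f (G (g t))))
  go {zero}  g = refl
  go {suc k} g with f (G (g zero))
  ... | true  = cong (_+_ 1ℤ) (go (λ t → g (suc t)))
  ... | false = trans (go (λ t → g (suc t))) (sym (ZP.+-identityˡ (sum (λ t → indicator (f (G (g (suc t))))))))

_<ᵇ_ : ∀ {n} → Fin n → Fin n → Bool
i <ᵇ j = ⌊ toℕ i ℕ.<? toℕ j ⌋

pairSum : ∀ {n} → (Fin n → Fin n → ℤ) → ℤ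
pairSum g = sum (λ i → sum (λ j → if i <ᵇ j then g i j else 0ℤ))

pairSum-distrib-+ : ∀ {n} (f g : Fin n → Fin n → ℤ) →
                    pairSum (λ i j → f i j + g i j) ≡ pairSum f + pairSum g
pairSum-distrib-+ {n} f g =
  trans (sum-cong-≗ {n} (λ i → trans (sum-cong-≗ {n} (λ j → if-+ (i <ᵇ j) (f i j) (g i j)))
                                     (∑-distrib-+ (masked f i) (masked g i))))
        (∑-distrib-+ (λ i → sum (masked f i)) (λ i → sum (masked g i)))
  where
  masked : (Fin n → Fin n → ℤ) → Fin n → Fin n → ℤ
  masked h i j = if i <ᵇ j then h i j else 0ℤ
  if-+ : ∀ b x y → (if b then x + y else 0ℤ) ≡ (if b then x else 0ℤ) + (if b then y else 0ℤ)
  if-+ true  x y = refl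
  if-+ false x y = refl

ℓ-as-sums : ∀ {n} (x : W n) → + ℓ x ≡
  pairSum (λ i j → indicator (isNeg (act x (ε i ⊖ ε j))) + indicator (isNeg (act x (ε i ⊕ ε j))))
  + sum (λ k → indicator (isNeg (act x (ε k ⊕ ε k))))
ℓ-as-sums {n} x = begin
  + count (map f (shortRoots ++ longRoots))
    ≡⟨ cong (λ bs → + count bs) (map-++ f shortRoots longRoots) ⟩
  + count (map f shortRoots ++ map f longRoots)
    ≡⟨ count-++ (map f shortRoots) _ ⟩
  + count (map f shortRoots) + + count (map f longRoots)
    ≡⟨ cong₂ _+_ (trans (count-concatMap f row (λ i → i))
                        (sum-cong-≗ λ i → trans (count-concatMap f (pair i) (λ j → j))
                                                (sum-cong-≗ λ j → count-pair (i <ᵇ j))))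
                 (count-map f (λ k → ε k ⊕ ε k)) ⟩
  _ ∎
  where
  open ≡-Reasoning
  f : Vect n → Bool
  f β = isNeg (act x β)
  pair : Fin n → Fin n → List (Vect n)
  pair i j = if i <ᵇ j then (ε i ⊖ ε j) ∷ (ε i ⊕ ε j) ∷ [] else []
  row : Fin n → List (Vect n)
  row i = concatMap (pair i) (allFin n)
  shortRoots longRoots : List (Vect n)
  shortRoots = concatMap row (allFin n)
  longRoots  = map (λ k → ε k ⊕ ε k) (allFin n)
  count-pair : ∀ {i j} b → + count (map f (if b then (ε i ⊖ ε j) ∷ (ε i ⊕ ε j) ∷ [] else []))
             ≡ (if b then indicator (f (ε i ⊖ ε j)) + indicator (f (ε i ⊕ ε j)) else 0ℤ)
  count-pair {i} {j} false = refl
  count-pair {i} {j} true with f (ε i ⊖ ε j) | f (ε i ⊕ ε j)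
  ... | true  | true  = refl
  ... | true  | false = refl
  ... | false | true  = refl
  ... | false | false = refl

<ᵇ-true : ∀ {n} {i j : Fin n} → toℕ i ℕ.< toℕ j → (i <ᵇ j) ≡ true
<ᵇ-true i<j = ⌊⌋-yes (_ ℕ.<? _) i<j

<ᵇ-false : ∀ {n} {i j : Fin n} → ¬ (toℕ i ℕ.< toℕ j) → (i <ᵇ j) ≡ false
<ᵇ-false i≮j = ⌊⌋-no (_ ℕ.<? _) i≮j

between : ∀ {n} → Fin n → Fin n → Fin n → Bool
between a b q = (a <ᵇ q) ∧ (q <ᵇ b)

if-- : ∀ b (x y : ℤ) → (if b then x else 0ℤ) - (if b then y else 0ℤ) ≡ (if b then x - y else 0ℤ)
if-- true  x y = refl
if-- false x y = refl

x-y+[y-x]≡0 : ∀ (x y : ℤ) → (x - y) + (y - x) ≡ 0ℤ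
x-y+[y-x]≡0 = solve-∀

-- The change of a pair sum when a and b are transposed: pairs avoiding {a, b} are unaffected, and the
-- contributions of those meeting {a, b} from outside [a, b] cancel.
transposeDefect : ∀ {n} → (Fin n → Fin n → ℤ) → Fin n → Fin n → ℤ
transposeDefect g a b =
  sum (λ q → if between a b q then (g q a - g q b) + (g b q - g a q) else 0ℤ) + (g b a - g a b)

module _ {n} (g : Fin n → Fin n → ℤ) {a b : Fin n} (a<b : toℕ a ℕ.< toℕ b) where

  private
    τ : Fin n → Fin n
    τ = PC.transpose a b

    a≢b : a ≢ b
    a≢b = FP.<⇒≢ a<b

    Δ : Fin n → Fin n → ℤ
    Δ i j = if i <ᵇ j then g (τ i) (τ j) - g i j else 0ℤ

    row : Fin n → ℤ
    row i = sum (Δ i)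

    G H : Fin n → ℤ
    G q = if between a b q then g q a - g q b else 0ℤ
    H q = if between a b q then g b q - g a q else 0ℤ

    Δ-outside : ∀ i j → i ≢ a → i ≢ b → j ≢ a → j ≢ b → Δ i j ≡ 0ℤ
    Δ-outside i j i≢a i≢b j≢a j≢b
      rewrite transpose-elsewhere a b i i≢a i≢b | transpose-elsewhere a b j j≢a j≢b
      with i <ᵇ j
    ... | true  = ZP.+-inverseʳ (g i j)
    ... | false = refl

    row-outside : ∀ i → i ≢ a → i ≢ b → row i ≡ G i
    row-outside i i≢a i≢b =
      trans (sum-pair (Δ i) a≢b (λ j j≢a j≢b → Δ-outside i j i≢a i≢b j≢a j≢b))
            (trans (cong₂ (λ u v → (if i <ᵇ a then g (τ i) u - g i a else 0ℤ)
                                   + (if i <ᵇ b then g (τ i) v - g i b else 0ℤ))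
                          (transpose-at-i a b) (transpose-at-j a b))
                   by-position)
      where
      τi≡i = transpose-elsewhere a b i i≢a i≢b
      by-position : (if i <ᵇ a then g (τ i) b - g i a else 0ℤ) + (if i <ᵇ b then g (τ i) a - g i b else 0ℤ)
                    ≡ G i
      by-position rewrite τi≡i with NP.<-cmp (toℕ i) (toℕ a)
      ... | tri≈ _ i≡a _ = ⊥-elim (i≢a (FP.toℕ-injective i≡a))
      ... | tri< i<a _ a≮i rewrite <ᵇ-true i<a | <ᵇ-true (NP.<-trans i<a a<b) | <ᵇ-false {i = a} {i} a≮i =
        x-y+[y-x]≡0 (g i b) (g i a)
      ... | tri> i≮a _ a<i with NP.<-cmp (toℕ i) (toℕ b)
      ...   | tri≈ _ i≡b _ = ⊥-elim (i≢b (FP.toℕ-injective i≡b))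
      ...   | tri< i<b _ _ rewrite <ᵇ-false {i = i} {a} i≮a | <ᵇ-true i<b | <ᵇ-true a<i = ZP.+-identityˡ _
      ...   | tri> i≮b _ _ rewrite <ᵇ-false {i = i} {a} i≮a | <ᵇ-false {i = i} {b} i≮b | <ᵇ-true a<i = refl

    column : Fin n → ℤ
    column j = Δ a j + Δ b j

    column-outside : ∀ j → j ≢ a → j ≢ b → column j ≡ H j
    column-outside j j≢a j≢b =
      trans (cong₂ (λ u v → (if a <ᵇ j then g u (τ j) - g a j else 0ℤ)
                          + (if b <ᵇ j then g v (τ j) - g b j else 0ℤ))
                   (transpose-at-i a b) (transpose-at-j a b))
            by-position
      where
      τj≡j = transpose-elsewhere a b j j≢a j≢b
      by-position : (if a <ᵇ j then g b (τ j) - g a j else 0ℤ) + (if b <ᵇ j then g a (τ j) - g b j else 0ℤ)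
                    ≡ H j
      by-position rewrite τj≡j with NP.<-cmp (toℕ j) (toℕ a)
      ... | tri≈ _ j≡a _ = ⊥-elim (j≢a (FP.toℕ-injective j≡a))
      ... | tri< j<a _ a≮j
        rewrite <ᵇ-false {i = a} {j} a≮j | <ᵇ-false {i = b} {j} (NP.<-asym (NP.<-trans j<a a<b)) = refl
      ... | tri> _ _ a<j with NP.<-cmp (toℕ j) (toℕ b)
      ...   | tri≈ _ j≡b _ = ⊥-elim (j≢b (FP.toℕ-injective j≡b))
      ...   | tri< j<b _ b≮j rewrite <ᵇ-true a<j | <ᵇ-false {i = b} {j} b≮j | <ᵇ-true j<b = ZP.+-identityʳ _
      ...   | tri> j≮b _ b<j rewrite <ᵇ-true a<j | <ᵇ-true b<j | <ᵇ-false {i = j} {b} j≮b =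
        x-y+[y-x]≡0 (g b j) (g a j)

    a≮a : ¬ (toℕ a ℕ.< toℕ a)
    a≮a = NP.<-irrefl refl
    b≮b : ¬ (toℕ b ℕ.< toℕ b)
    b≮b = NP.<-irrefl refl

    column-a : column a ≡ 0ℤ
    column-a rewrite <ᵇ-false {i = a} {a} a≮a | <ᵇ-false {i = b} {a} (NP.<-asym a<b) = refl

    column-b : column b ≡ g b a - g a b
    column-b rewrite <ᵇ-true a<b | <ᵇ-false {i = b} {b} b≮b | transpose-at-i a b | transpose-at-j a b =
      ZP.+-identityʳ _

    G-a : G a ≡ 0ℤ
    G-a rewrite <ᵇ-false {i = a} {a} a≮a = refl
    G-b : G b ≡ 0ℤ
    G-b rewrite <ᵇ-false {i = b} {b} b≮b | <ᵇ-true a<b = refl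
    H-a : H a ≡ 0ℤ
    H-a rewrite <ᵇ-false {i = a} {a} a≮a = refl
    H-b : H b ≡ 0ℤ
    H-b rewrite <ᵇ-false {i = b} {b} b≮b | <ᵇ-true a<b = refl

    G+H : ∀ q → G q + H q ≡ (if between a b q then (g q a - g q b) + (g b q - g a q) else 0ℤ)
    G+H q with between a b q
    ... | true  = refl
    ... | false = refl

  pairSum-transpose : pairSum (λ i j → g (τ i) (τ j)) - pairSum g ≡ transposeDefect g a b
  pairSum-transpose = begin
    pairSum (λ i j → g (τ i) (τ j)) - pairSum g
      ≡⟨ sym (∑-distrib-- (λ i → sum (masked gτ i)) (λ i → sum (masked g i))) ⟩
    sum (λ i → sum (masked gτ i) - sum (masked g i))
      ≡⟨ sum-cong-≗ {n} (λ i → trans (sym (∑-distrib-- (masked gτ i) (masked g i)))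
                                     (sum-cong-≗ {n} (λ j → if-- (i <ᵇ j) (gτ i j) (g i j)))) ⟩
    sum row
      ≡⟨ sum-split-pair row G a≢b (λ i i≢a i≢b → row-outside i i≢a i≢b) G-a G-b ⟩
    sum G + (row a + row b)
      ≡⟨ cong (_+_ (sum G)) (sym (∑-distrib-+ (Δ a) (Δ b))) ⟩
    sum G + sum column
      ≡⟨ cong (_+_ (sum G)) (sum-split-pair column H a≢b column-outside H-a H-b) ⟩
    sum G + (sum H + (column a + column b))
      ≡⟨ cong₂ (λ u v → sum G + (sum H + (u + v))) column-a column-b ⟩
    sum G + (sum H + (0ℤ + (g b a - g a b)))
      ≡⟨ reassociate (sum G) (sum H) (g b a - g a b) ⟩
    sum G + sum H + (g b a - g a b)
      ≡⟨ cong (_+ (g b a - g a b)) (trans (sym (∑-distrib-+ G H)) (sum-cong-≗ G+H)) ⟩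
    transposeDefect g a b ∎
    where
    open ≡-Reasoning
    gτ : Fin n → Fin n → ℤ
    gτ i j = g (τ i) (τ j)
    masked : (Fin n → Fin n → ℤ) → Fin n → Fin n → ℤ
    masked h i j = if i <ᵇ j then h i j else 0ℤ
    reassociate : ∀ x y z → x + (y + (0ℤ + z)) ≡ x + y + z
    reassociate = solve-∀

  pairSum-transpose-symmetric : (∀ i j → g i j ≡ g j i) → pairSum (λ i j → g (τ i) (τ j)) ≡ pairSum g
  pairSum-transpose-symmetric g-sym = begin
    pairSum (λ i j → g (τ i) (τ j))                                ≡⟨ x≡y+[x-y] _ (pairSum g) ⟩
    pairSum g + (pairSum (λ i j → g (τ i) (τ j)) - pairSum g)
                                                                   ≡⟨ cong (_+_ (pairSum g)) pairSum-transpose ⟩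
    pairSum g + transposeDefect g a b                              ≡⟨ cong (_+_ (pairSum g)) defect≡0 ⟩
    pairSum g + 0ℤ                                                 ≡⟨ ZP.+-identityʳ (pairSum g) ⟩
    pairSum g ∎
    where
    open ≡-Reasoning
    x≡y+[x-y] : ∀ x y → x ≡ y + (x - y)
    x≡y+[x-y] = solve-∀
    term≡0 : ∀ q → (if between a b q then (g q a - g q b) + (g b q - g a q) else 0ℤ) ≡ 0ℤ
    term≡0 q with between a b q
    ... | false = refl
    ... | true rewrite g-sym q a | g-sym q b = x-y+[y-x]≡0 (g a q) (g b q)
    defect≡0 : transposeDefect g a b ≡ 0ℤ
    defect≡0 rewrite sum-zero term≡0 | g-sym b a = trans (ZP.+-identityˡ _) (ZP.+-inverseʳ (g a b))

pairSum-cong : ∀ {n} {f g : Fin n → Fin n → ℤ} → (∀ i j → toℕ i ℕ.< toℕ j → f i j ≡ g i j) →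
               pairSum f ≡ pairSum g
pairSum-cong {n} {f} {g} f≡g = sum-cong-≗ {n} λ i → sum-cong-≗ {n} λ j → on-pair i j
  where
  on-pair : ∀ i j → (if i <ᵇ j then f i j else 0ℤ) ≡ (if i <ᵇ j then g i j else 0ℤ)
  on-pair i j with toℕ i ℕ.<? toℕ j
  ... | yes i<j = f≡g i j i<j
  ... | no  _   = refl

ascent : ∀ {n} → (Fin n → ℤ) → Fin n → Fin n → ℤ
ascent K i j = indicator ⌊ K i ℤ.<? K j ⌋

negatedAscent : ∀ {n} → (Fin n → ℤ) → Fin n → Fin n → ℤ
negatedAscent K i j = indicator ⌊ K i ℤ.<? - K j ⌋

<-neg-flip : ∀ {x y} → x ℤ.< - y → y ℤ.< - x
<-neg-flip {x} {y} x<-y = subst (ℤ._< - x) (ZP.neg-involutive y) (ZP.neg-mono-< x<-y)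

negatedAscent-symmetric : ∀ {n} (K : Fin n → ℤ) i j → negatedAscent K i j ≡ negatedAscent K j i
negatedAscent-symmetric K i j with K i ℤ.<? - K j | K j ℤ.<? - K i
... | yes _    | yes _    = refl
... | no  _    | no  _    = refl
... | yes i<-j | no j≮-i = ⊥-elim (j≮-i (<-neg-flip i<-j))
... | no i≮-j  | yes j<-i = ⊥-elim (i≮-j (<-neg-flip j<-i))

ℓ-window : ∀ {n} (x : W n) → + ℓ x ≡
  pairSum (ascent (window x)) + pairSum (negatedAscent (window x)) + sum (λ k → indicator (neg x k))
ℓ-window x = trans (ℓ-as-sums x) (cong₂ _+_
  (trans (pairSum-cong λ i j i<j → cong₂ (λ u v → indicator u + indicator v)
                                          (isNeg-act-minus x (FP.<⇒≢ i<j)) (isNeg-act-plus x (FP.<⇒≢ i<j)))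
         (pairSum-distrib-+ (ascent (window x)) (negatedAscent (window x))))
  (sum-cong-≗ λ k → cong indicator (isNeg-act-long x k)))

-- Right multiplication by s_(a,b) transposes the window, so only the ascent count changes.
ℓ-·-reflection : ∀ {n} (x : W n) {a b : Fin n} (a<b : a F.< b) →
                 + ℓ (x · sᵣ (minus a b a<b)) - + ℓ x
                 ≡ pairSum (ascent (λ k → window x (PC.transpose a b k))) - pairSum (ascent (window x))
ℓ-·-reflection x {a} {b} a<b = begin
  + ℓ (x · sᵣ (minus a b a<b)) - + ℓ x
    ≡⟨ cong₂ _-_ (ℓ-window (x · sᵣ (minus a b a<b))) (ℓ-window x) ⟩
  (A′ + pairSum (negatedAscent (λ k → K (τ k))) + sum (λ k → indicator (neg x (τ k)))) - (A + B + C)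
    ≡⟨ cong₂ (λ u v → (A′ + u + v) - (A + B + C))
             (pairSum-transpose-symmetric (negatedAscent K) a<b (negatedAscent-symmetric K))
             (sum-transpose (λ k → indicator (neg x k)) a b) ⟩
  (A′ + B + C) - (A + B + C)
    ≡⟨ cancel A′ B C A ⟩
  A′ - A ∎
  where
  open ≡-Reasoning
  K = window x
  τ = PC.transpose a b
  A′ = pairSum (ascent (λ k → K (τ k)))
  A  = pairSum (ascent K)
  B  = pairSum (negatedAscent K)
  C  = sum (λ k → indicator (neg x k))
  cancel : ∀ a′ b c a → (a′ + b + c) - (a + b + c) ≡ a′ - a
  cancel = solve-∀

between⇒ : ∀ {n} {a b q : Fin n} → between a b q ≡ true → a F.< q × q F.< b
between⇒ {a = a} {b} {q} a<q<b with toℕ a ℕ.<? toℕ q | toℕ q ℕ.<? toℕ b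
... | yes a<q | yes q<b = a<q , q<b
between⇒ () | yes _ | no _
between⇒ () | no  _ | _

inside : ℤ → ℤ → ℤ → Bool
inside lo hi z = ⌊ lo ℤ.<? z ⌋ ∧ ⌊ z ℤ.<? hi ⌋

valuesBetween : ∀ {n} → (Fin n → ℤ) → Fin n → Fin n → ℤ → ℤ → ℤ
valuesBetween K a b lo hi = sum (λ q → if between a b q then indicator (inside lo hi (K q)) else 0ℤ)

crossing-count : ∀ {lo hi z} → lo ℤ.< hi → z ≢ lo → z ≢ hi →
                 (indicator ⌊ z ℤ.<? hi ⌋ - indicator ⌊ z ℤ.<? lo ⌋)
                 + (indicator ⌊ lo ℤ.<? z ⌋ - indicator ⌊ hi ℤ.<? z ⌋)
                 ≡ + 2 * indicator (inside lo hi z)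
crossing-count {lo} {hi} {z} lo<hi z≢lo z≢hi with ZP.<-cmp z lo
... | tri≈ _ z≡lo _ = ⊥-elim (z≢lo z≡lo)
... | tri< z<lo _ _
  rewrite ⌊⌋-yes (z ℤ.<? hi) (ZP.<-trans z<lo lo<hi) | ⌊⌋-yes (z ℤ.<? lo) z<lo
        | ⌊⌋-no (lo ℤ.<? z) (ZP.<-asym z<lo) | ⌊⌋-no (hi ℤ.<? z) (ZP.<-asym (ZP.<-trans z<lo lo<hi)) = refl
... | tri> _ _ lo<z with ZP.<-cmp z hi
...   | tri≈ _ z≡hi _ = ⊥-elim (z≢hi z≡hi)
...   | tri< z<hi _ _
  rewrite ⌊⌋-yes (z ℤ.<? hi) z<hi | ⌊⌋-no (z ℤ.<? lo) (ZP.<-asym lo<z)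
        | ⌊⌋-yes (lo ℤ.<? z) lo<z | ⌊⌋-no (hi ℤ.<? z) (ZP.<-asym z<hi) = refl
...   | tri> _ _ hi<z
  rewrite ⌊⌋-no (z ℤ.<? hi) (ZP.<-asym hi<z) | ⌊⌋-no (z ℤ.<? lo) (ZP.<-asym lo<z)
        | ⌊⌋-yes (lo ℤ.<? z) lo<z | ⌊⌋-yes (hi ℤ.<? z) hi<z = refl

module _ {n} (K : Fin n → ℤ) (K-injective : ∀ {i j} → i ≢ j → K i ≢ K j)
         {a b : Fin n} (a<b : a F.< b) where

  private
    defect-sum : ∀ (e : Fin n → ℤ) (c : ℤ) (f : Fin n → ℤ) →
                 (∀ q → q ≢ a → q ≢ b → e q ≡ c * f q) →
                 sum (λ q → if between a b q then e q else 0ℤ)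
                 ≡ c * sum (λ q → if between a b q then f q else 0ℤ)
    defect-sum e c f e≡cf =
      trans (sum-cong-≗ {n} termwise) (sym (*-distribˡ-sum c (λ q → if between a b q then f q else 0ℤ)))
      where
      termwise : ∀ q → (if between a b q then e q else 0ℤ) ≡ c * (if between a b q then f q else 0ℤ)
      termwise q with between a b q in inRange
      ... | true  = let a<q , q<b = between⇒ {a = a} {b} {q} inRange in
                    e≡cf q (λ { refl → FP.<-irrefl refl a<q }) (λ { refl → FP.<-irrefl refl q<b })
      ... | false = sym (ZP.*-zeroʳ c)

    crossing : Fin n → ℤ
    crossing q = (ascent K q a - ascent K q b) + (ascent K b q - ascent K a q)

  ascent-defect-descent : K b ℤ.< K a →
    transposeDefect (ascent K) a b ≡ + 2 * valuesBetween K a b (K b) (K a) + 1ℤ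
  ascent-defect-descent Kb<Ka =
    cong₂ _+_ (defect-sum crossing (+ 2) (λ q → indicator (inside (K b) (K a) (K q))) λ q q≢a q≢b →
                 crossing-count Kb<Ka (K-injective q≢b) (K-injective q≢a))
              (cong₂ (λ u v → indicator u - indicator v)
                     (⌊⌋-yes (K b ℤ.<? K a) Kb<Ka) (⌊⌋-no (K a ℤ.<? K b) (ZP.<-asym Kb<Ka)))

  ascent-defect-ascent : K a ℤ.< K b →
    transposeDefect (ascent K) a b ≡ - (+ 2 * valuesBetween K a b (K a) (K b)) - 1ℤ
  ascent-defect-ascent Ka<Kb =
    cong₂ _+_ (trans (defect-sum crossing (- + 2) (λ q → indicator (inside (K a) (K b) (K q))) λ q q≢a q≢b →
                        trans (negate (ascent K q a) (ascent K q b) (ascent K b q) (ascent K a q))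
                              (trans (cong -_ (crossing-count Ka<Kb (K-injective q≢a) (K-injective q≢b)))
                                     (ZP.neg-distribˡ-* (+ 2) (indicator (inside (K a) (K b) (K q))))))
                     (sym (ZP.neg-distribˡ-* (+ 2) (valuesBetween K a b (K a) (K b)))))
              (cong₂ (λ u v → indicator u - indicator v)
                     (⌊⌋-no (K b ℤ.<? K a) (ZP.<-asym Ka<Kb)) (⌊⌋-yes (K a ℤ.<? K b) Ka<Kb))
    where
    negate : ∀ p q r s → (p - q) + (r - s) ≡ - ((q - p) + (s - r))
    negate = solve-∀

ρ≡n-k : ∀ {n} (k : Fin n) → ρ k ≡ + n - + toℕ k
ρ≡n-k {n} k = sym (trans (ZP.m-n≡m⊖n n (toℕ k)) (ZP.⊖-≥ (NP.<⇒≤ (FP.toℕ<n k))))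

⟨ρ,coroot-minus⟩ : ∀ {n} {a b : Fin n} (a<b : a F.< b) →
                   ⟨ ρ , coroot (minus a b a<b) ⟩ ≡ + toℕ b - + toℕ a
⟨ρ,coroot-minus⟩ {n} {a} {b} a<b = begin
  Σℤ term           ≡⟨ Σℤ≡sum term ⟩
  sum term          ≡⟨ sum-pair term a≢b vanishes ⟩
  term a + term b   ≡⟨ cong₂ _+_ term-a term-b ⟩
  ρ a + - ρ b       ≡⟨ cong₂ (λ u v → u + - v) (ρ≡n-k a) (ρ≡n-k b) ⟩
  (+ n - + toℕ a) - (+ n - + toℕ b) ≡⟨ cancel (+ n) (+ toℕ a) (+ toℕ b) ⟩
  + toℕ b - + toℕ a ∎
  where
  open ≡-Reasoning
  term : Fin n → ℤ
  term k = ρ k * (ε a ⊖ ε b) k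
  a≢b = FP.<⇒≢ a<b
  vanishes : ∀ k → k ≢ a → k ≢ b → term k ≡ 0ℤ
  vanishes k k≢a k≢b rewrite ε-offdiag a k k≢a | ε-offdiag b k k≢b = ZP.*-zeroʳ (ρ k)
  term-a : term a ≡ ρ a
  term-a rewrite ε-diag a | ε-offdiag b a a≢b = ZP.*-identityʳ (ρ a)
  term-b : term b ≡ - ρ b
  term-b rewrite ε-diag b | ε-offdiag a b (λ b≡a → a≢b (sym b≡a)) =
    trans (ZP.*-comm (ρ b) (- 1ℤ)) (ZP.-1*i≡-i (ρ b))
  cancel : ∀ N A B → (N - A) - (N - B) ≡ B - A
  cancel = solve-∀

<ᵇ≡ℕ<ᵇ : ∀ {n} (i j : Fin n) → (i <ᵇ j) ≡ (toℕ i ℕ.<ᵇ toℕ j)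
<ᵇ≡ℕ<ᵇ i j = trans (⌊⌋-map′ _ _ (T? (toℕ i ℕ.<ᵇ toℕ j))) (⌊T?⌋ (toℕ i ℕ.<ᵇ toℕ j))
  where
  ⌊T?⌋ : ∀ b → ⌊ T? b ⌋ ≡ b
  ⌊T?⌋ true  = refl
  ⌊T?⌋ false = refl

count-between : ∀ {n} (a b : Fin n) → sum (λ q → indicator (between a b q)) ≡ + (toℕ b ℕ.∸ suc (toℕ a))
count-between {n} a b =
  trans (sum-cong-≗ {n} λ q → cong indicator (cong₂ _∧_ (<ᵇ≡ℕ<ᵇ a q) (<ᵇ≡ℕ<ᵇ q b)))
        (count-open-interval n (toℕ a) (toℕ b) (NP.<⇒≤ (FP.toℕ<n b)))

between-true : ∀ {n} {a b q : Fin n} → a F.< q → q F.< b → between a b q ≡ true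
between-true a<q q<b rewrite <ᵇ-true a<q | <ᵇ-true q<b = refl

inside-true : ∀ {lo hi z} → lo ℤ.< z → z ℤ.< hi → inside lo hi z ≡ true
inside-true {lo} {hi} {z} lo<z z<hi rewrite ⌊⌋-yes (lo ℤ.<? z) lo<z | ⌊⌋-yes (z ℤ.<? hi) z<hi = refl

inside⇒ : ∀ lo hi z → inside lo hi z ≡ true → lo ℤ.< z × z ℤ.< hi
inside⇒ lo hi z lo<z<hi with lo ℤ.<? z | z ℤ.<? hi
... | yes lo<z | yes z<hi = lo<z , z<hi
inside⇒ lo hi z () | yes _ | no _
inside⇒ lo hi z () | no  _ | _

indicator-nonneg : ∀ b → 0ℤ ℤ.≤ indicator b
indicator-nonneg true  = ℤ.+≤+ ℕ.z≤n
indicator-nonneg false = ℤ.+≤+ ℕ.z≤n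

indicator-complement-nonneg : ∀ b → 0ℤ ℤ.≤ 1ℤ - indicator b
indicator-complement-nonneg true  = ℤ.+≤+ ℕ.z≤n
indicator-complement-nonneg false = ℤ.+≤+ ℕ.z≤n

if-nonneg : ∀ b {z} → 0ℤ ℤ.≤ z → 0ℤ ℤ.≤ (if b then z else 0ℤ)
if-nonneg true  0≤z = 0≤z
if-nonneg false _   = ℤ.+≤+ ℕ.z≤n

module _ {n} (K : Fin n → ℤ) (a b : Fin n) (lo hi : ℤ) where

  private
    term : Fin n → ℤ
    term q = if between a b q then indicator (inside lo hi (K q)) else 0ℤ

    missing : Fin n → ℤ
    missing q = if between a b q then 1ℤ - indicator (inside lo hi (K q)) else 0ℤ

    span : ℤ
    span = + (toℕ b ℕ.∸ suc (toℕ a))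

    missing-sum : sum missing ≡ span - valuesBetween K a b lo hi
    missing-sum = trans (sum-cong-≗ {n} (λ q → sym (if-- (between a b q) 1ℤ (indicator (inside lo hi (K q))))))
                        (trans (∑-distrib-- (λ q → indicator (between a b q)) term)
                               (cong (_- valuesBetween K a b lo hi) (count-between a b)))

  valuesBetween-nonneg : 0ℤ ℤ.≤ valuesBetween K a b lo hi
  valuesBetween-nonneg = sum-nonneg term (λ q → if-nonneg (between a b q) (indicator-nonneg (inside lo hi (K q))))

  valuesBetween≡0⇒none : valuesBetween K a b lo hi ≡ 0ℤ →
                         ∀ q → a F.< q → q F.< b → ¬ (lo ℤ.< K q × K q ℤ.< hi)
  valuesBetween≡0⇒none S≡0 q a<q q<b (lo<Kq , Kq<hi) with
    nonneg-sum≡0⇒≡0 term (λ q → if-nonneg (between a b q) (indicator-nonneg (inside lo hi (K q)))) S≡0 q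
  ... | term≡0 rewrite between-true a<q q<b | inside-true lo<Kq Kq<hi with term≡0
  ... | ()

  none⇒valuesBetween≡0 : (∀ q → a F.< q → q F.< b → ¬ (lo ℤ.< K q × K q ℤ.< hi)) →
                         valuesBetween K a b lo hi ≡ 0ℤ
  none⇒valuesBetween≡0 none = sum-zero term≡0
    where
    term≡0 : ∀ q → term q ≡ 0ℤ
    term≡0 q with between a b q in inRange | inside lo hi (K q) in isInside
    ... | false | _     = refl
    ... | true  | false = refl
    ... | true  | true  = let a<q , q<b = between⇒ {a = a} {b} {q} inRange in
                          ⊥-elim (none q a<q q<b (inside⇒ lo hi (K q) isInside))

  valuesBetween≡span⇒all : valuesBetween K a b lo hi ≡ + (toℕ b ℕ.∸ suc (toℕ a)) →
                           ∀ q → a F.< q → q F.< b → lo ℤ.< K q × K q ℤ.< hi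
  valuesBetween≡span⇒all S≡span q a<q q<b with
    nonneg-sum≡0⇒≡0 missing
      (λ q → if-nonneg (between a b q) (indicator-complement-nonneg (inside lo hi (K q))))
      (trans missing-sum (trans (cong (_-_ span) S≡span) (ZP.+-inverseʳ span))) q
  ... | missing≡0 rewrite between-true a<q q<b with inside lo hi (K q) in isInside
  ... | true = inside⇒ lo hi (K q) isInside
  ... | false with missing≡0
  ... | ()

  all⇒valuesBetween≡span : (∀ q → a F.< q → q F.< b → lo ℤ.< K q × K q ℤ.< hi) →
                           valuesBetween K a b lo hi ≡ + (toℕ b ℕ.∸ suc (toℕ a))
  all⇒valuesBetween≡span all = trans (sum-cong-≗ {n} term≡1) (count-between a b)
    where
    term≡1 : ∀ q → term q ≡ indicator (between a b q)
    term≡1 q with between a b q in inRange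
    ... | false = refl
    ... | true  = let a<q , q<b = between⇒ {a = a} {b} {q} inRange
                      lo<Kq , Kq<hi = all q a<q q<b in
                  cong indicator (inside-true lo<Kq Kq<hi)

-- Edges w → w s_(a,b) of the quantum Bruhat graph

BruhatGap : ∀ {n} → (Fin n → ℤ) → Fin n → Fin n → Set
BruhatGap K a b = K b ℤ.< K a × (∀ q → a F.< q → q F.< b → ¬ (K b ℤ.< K q × K q ℤ.< K a))

QuantumSpan : ∀ {n} → (Fin n → ℤ) → Fin n → Fin n → Set
QuantumSpan K a b = K a ℤ.< K b × (∀ q → a F.< q → q F.< b → K a ℤ.< K q × K q ℤ.< K b)

twice≡0⇒≡0 : ∀ {X} → + 2 * X ≡ 0ℤ → X ≡ 0ℤ
twice≡0⇒≡0 {X} 2X≡0 = ZP.*-cancelˡ-≡ (+ 2) X 0ℤ (trans 2X≡0 (sym (ZP.*-zeroʳ (+ 2))))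

span-length : ∀ {n} {a b : Fin n} → a F.< b → + toℕ b - + toℕ a - 1ℤ ≡ + (toℕ b ℕ.∸ suc (toℕ a))
span-length {a = a} {b} a<b =
  trans (reassociate (+ toℕ b) (+ toℕ a)) (trans (ZP.m-n≡m⊖n (toℕ b) (suc (toℕ a))) (ZP.⊖-≥ a<b))
  where
  reassociate : ∀ x y → x - y - 1ℤ ≡ x - (1ℤ + y)
  reassociate = solve-∀

2S+1≡1⇒S≡0 : ∀ {S} → + 2 * S + 1ℤ ≡ 1ℤ → S ≡ 0ℤ
2S+1≡1⇒S≡0 {S} e = twice≡0⇒≡0 (trans (rearrange S) (trans (cong (_- 1ℤ) e) refl))
  where
  rearrange : ∀ S → + 2 * S ≡ + 2 * S + 1ℤ - 1ℤ
  rearrange = solve-∀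

2S+1≢1-2d : ∀ {S d} → 0ℤ ℤ.≤ S → 0ℤ ℤ.< d → + 2 * S + 1ℤ ≢ 1ℤ - + 2 * d
2S+1≢1-2d {S} {d} 0≤S 0<d e = ZP.<-irrefl (sym S+d≡0) (ZP.+-mono-≤-< 0≤S 0<d)
  where
  rearrange : ∀ S d → + 2 * (S + d) ≡ (+ 2 * S + 1ℤ) - (1ℤ - + 2 * d)
  rearrange = solve-∀
  S+d≡0 : S + d ≡ 0ℤ
  S+d≡0 = twice≡0⇒≡0
    (trans (rearrange S d) (trans (cong (_- (1ℤ - + 2 * d)) e) (ZP.+-inverseʳ (1ℤ - + 2 * d))))

-2S-1≢1 : ∀ {S} → 0ℤ ℤ.≤ S → - (+ 2 * S) - 1ℤ ≢ 1ℤ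
-2S-1≢1 {S} 0≤S e = ZP.<-irrefl (sym S+1≡0) (ZP.+-mono-≤-< 0≤S (ℤ.+<+ (ℕ.s≤s ℕ.z≤n)))
  where
  rearrange : ∀ S → + 2 * (S + 1ℤ) ≡ 1ℤ - (- (+ 2 * S) - 1ℤ)
  rearrange = solve-∀
  S+1≡0 : S + 1ℤ ≡ 0ℤ
  S+1≡0 = twice≡0⇒≡0 (trans (rearrange S) (cong (_-_ 1ℤ) e))

-2S-1≡1-2d⇒S≡d-1 : ∀ {S d} → - (+ 2 * S) - 1ℤ ≡ 1ℤ - + 2 * d → S ≡ d - 1ℤ
-2S-1≡1-2d⇒S≡d-1 {S} {d} e =
  trans (split S (d - 1ℤ)) (trans (cong (_+ (d - 1ℤ)) difference≡0) (ZP.+-identityˡ (d - 1ℤ)))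
  where
  split : ∀ x y → x ≡ (x - y) + y
  split = solve-∀
  rearrange : ∀ S d → + 2 * (S - (d - 1ℤ)) ≡ (1ℤ - + 2 * d) - (- (+ 2 * S) - 1ℤ)
  rearrange = solve-∀
  difference≡0 : S - (d - 1ℤ) ≡ 0ℤ
  difference≡0 = twice≡0⇒≡0 (trans (rearrange S d)
    (trans (cong (_-_ (1ℤ - + 2 * d)) e) (ZP.+-inverseʳ (1ℤ - + 2 * d))))

module _ {n} (x : W n) {a b : Fin n} (a<b : a F.< b) where

  private
    K : Fin n → ℤ
    K = window x

    ℓ′ : ℕ
    ℓ′ = ℓ (x · sᵣ (minus a b a<b))

    d : ℤ
    d = + toℕ b - + toℕ a

    0<d : 0ℤ ℤ.< d
    0<d = subst (0ℤ ℤ.<_) (sym (trans (ZP.m-n≡m⊖n (toℕ b) (toℕ a)) (ZP.⊖-≥ (NP.<⇒≤ a<b))))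
                (ℤ.+<+ (NP.m<n⇒0<n∸m a<b))

    descent-change : K b ℤ.< K a → + ℓ′ - + ℓ x ≡ + 2 * valuesBetween K a b (K b) (K a) + 1ℤ
    descent-change Kb<Ka = trans (ℓ-·-reflection x a<b)
      (trans (pairSum-transpose (ascent K) a<b) (ascent-defect-descent K (window-injective x) a<b Kb<Ka))

    ascent-change : K a ℤ.< K b → + ℓ′ - + ℓ x ≡ - (+ 2 * valuesBetween K a b (K a) (K b)) - 1ℤ
    ascent-change Ka<Kb = trans (ℓ-·-reflection x a<b)
      (trans (pairSum-transpose (ascent K) a<b) (ascent-defect-ascent K (window-injective x) a<b Ka<Kb))

    bruhat⇒ : ℓ′ ≡ suc (ℓ x) → + ℓ′ - + ℓ x ≡ 1ℤ
    bruhat⇒ ℓ′≡ rewrite ℓ′≡ = cancel (+ ℓ x)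
      where
      cancel : ∀ L → (1ℤ + L) - L ≡ 1ℤ
      cancel = solve-∀

    ⇒bruhat : + ℓ′ - + ℓ x ≡ 1ℤ → ℓ′ ≡ suc (ℓ x)
    ⇒bruhat D≡1 = ZP.+-injective (trans (split (+ ℓ′) (+ ℓ x)) (cong (_+ + ℓ x) D≡1))
      where
      split : ∀ X L → X ≡ (X - L) + L
      split = solve-∀

    quantum⇒ : + ℓ′ ≡ + ℓ x - + 2 * ⟨ ρ , coroot (minus a b a<b) ⟩ + 1ℤ →
               + ℓ′ - + ℓ x ≡ 1ℤ - + 2 * d
    quantum⇒ ℓ′≡ rewrite ⟨ρ,coroot-minus⟩ a<b | ℓ′≡ = cancel (+ ℓ x) d
      where
      cancel : ∀ L d → L - + 2 * d + 1ℤ - L ≡ 1ℤ - + 2 * d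
      cancel = solve-∀

    ⇒quantum : + ℓ′ - + ℓ x ≡ 1ℤ - + 2 * d →
               + ℓ′ ≡ + ℓ x - + 2 * ⟨ ρ , coroot (minus a b a<b) ⟩ + 1ℤ
    ⇒quantum D≡ rewrite ⟨ρ,coroot-minus⟩ a<b =
      trans (split (+ ℓ′) (+ ℓ x)) (trans (cong (_+ + ℓ x) D≡) (reorder (+ ℓ x) d))
      where
      split : ∀ X L → X ≡ (X - L) + L
      split = solve-∀
      reorder : ∀ L d → 1ℤ - + 2 * d + L ≡ L - + 2 * d + 1ℤ
      reorder = solve-∀

  edge⇒gapOrSpan : QBGEdge x (minus a b a<b) → BruhatGap K a b ⊎ QuantumSpan K a b
  edge⇒gapOrSpan edge with ZP.<-cmp (K a) (K b)
  ... | tri≈ _ Ka≡Kb _ = ⊥-elim (window-injective x (FP.<⇒≢ a<b) Ka≡Kb)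
  ... | tri> _ _ Kb<Ka = inj₁ (Kb<Ka , valuesBetween≡0⇒none K a b (K b) (K a) (no-values edge))
    where
    no-values : QBGEdge x (minus a b a<b) → valuesBetween K a b (K b) (K a) ≡ 0ℤ
    no-values (inj₁ e) = 2S+1≡1⇒S≡0 (trans (sym (descent-change Kb<Ka)) (bruhat⇒ e))
    no-values (inj₂ e) = ⊥-elim (2S+1≢1-2d {d = d} (valuesBetween-nonneg K a b (K b) (K a)) 0<d
                                            (trans (sym (descent-change Kb<Ka)) (quantum⇒ e)))
  ... | tri< Ka<Kb _ _ = inj₂ (Ka<Kb , valuesBetween≡span⇒all K a b (K a) (K b) (all-values edge))
    where
    all-values : QBGEdge x (minus a b a<b) → valuesBetween K a b (K a) (K b) ≡ + (toℕ b ℕ.∸ suc (toℕ a))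
    all-values (inj₁ e) = ⊥-elim (-2S-1≢1 (valuesBetween-nonneg K a b (K a) (K b))
                                          (trans (sym (ascent-change Ka<Kb)) (bruhat⇒ e)))
    all-values (inj₂ e) = trans (-2S-1≡1-2d⇒S≡d-1 {d = d} (trans (sym (ascent-change Ka<Kb)) (quantum⇒ e)))
                                (span-length a<b)

  gapOrSpan⇒edge : BruhatGap K a b ⊎ QuantumSpan K a b → QBGEdge x (minus a b a<b)
  gapOrSpan⇒edge (inj₁ (Kb<Ka , none)) = inj₁ (⇒bruhat
    (trans (descent-change Kb<Ka) (cong (λ S → + 2 * S + 1ℤ) (none⇒valuesBetween≡0 K a b (K b) (K a) none))))
  gapOrSpan⇒edge (inj₂ (Ka<Kb , all)) = inj₂ (⇒quantum
    (trans (ascent-change Ka<Kb)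
           (trans (cong (λ S → - (+ 2 * S) - 1ℤ)
                        (trans (all⇒valuesBetween≡span K a b (K a) (K b) all) (sym (span-length a<b))))
                  (simplify d))))
    where
    simplify : ∀ d → - (+ 2 * (d - 1ℤ)) - 1ℤ ≡ 1ℤ - + 2 * d
    simplify = solve-∀

-- Comparing the edges out of w and out of the end of the path

window-⋆-untouched : ∀ {n k} {I : Set} (a : I → Fin n) {m : Fin n} (a<m : ∀ t → a t < m)
                     (y : W n) (h : Fin k → I) {q : Fin n} → q ≢ m → (∀ t → q ≢ a (h t)) →
                     window (y ⋆ map (λ t → ⦅ a t , m ⦆ (a<m t)) (tabulate h)) q ≡ window y q
window-⋆-untouched {k = zero}  a a<m y h q≢m q≢a = refl
window-⋆-untouched {k = suc k} a {m} a<m y h {q} q≢m q≢a =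
  trans (window-⋆-untouched a a<m (y · sᵣ (⦅ a (h zero) , m ⦆ (a<m (h zero)))) (λ t → h (suc t))
                            q≢m (λ t → q≢a (suc t)))
        (cong (window y) (transpose-elsewhere (a (h zero)) m q (q≢a zero) q≢m))

module _ {n} (w : W n) {m : Fin n} {s} (a : Fin (suc s) → Fin n)
         (a-incr : ∀ t u → t < u → a t < a u) (a<m : ∀ t → a t < m) where

  private
    path : W n
    path = w ⋆ map (λ t → ⦅ a t , m ⦆ (a<m t)) (allFin (suc s))

    a₁<later : ∀ t → a zero < a (suc t)
    a₁<later t = a-incr zero (suc t) (ℕ.s≤s ℕ.z≤n)

  window-path-below : ∀ q → q < a zero → window path q ≡ window w q
  window-path-below q q<a₁ =
    trans (window-⋆-untouched a a<m _ suc (FP.<⇒≢ (<-trans q<a₁ (a<m zero)))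
                              (λ t → FP.<⇒≢ (<-trans q<a₁ (a₁<later t))))
          (cong (window w)
                (transpose-elsewhere (a zero) m q (FP.<⇒≢ q<a₁) (FP.<⇒≢ (<-trans q<a₁ (a<m zero)))))

  window-path-start : window path (a zero) ≡ window w m
  window-path-start =
    trans (window-⋆-untouched a a<m _ suc (FP.<⇒≢ (a<m zero)) (λ t → FP.<⇒≢ (a₁<later t)))
          (cong (window w) (transpose-at-i (a zero) m))

module _ {n} (K K′ : Fin n → ℤ) {c p a m : Fin n} (c<p : c < p) (p<a : p < a)
         (K′-below : ∀ q → q < a → K′ q ≡ K q) (K′-a : K′ a ≡ K m) where

  private
    K′-c : K′ c ≡ K c
    K′-c = K′-below c (<-trans c<p p<a)

    gap-below : BruhatGap K′ c a → ∀ q → c < q → q < a → ¬ (K m ℤ.< K q × K q ℤ.< K c)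
    gap-below (_ , gap) q c<q q<a (Km<Kq , Kq<Kc) = gap q c<q q<a
      ( subst₂ ℤ._<_ (sym K′-a) (sym (K′-below q q<a)) Km<Kq
      , subst₂ ℤ._<_ (sym (K′-below q q<a)) (sym K′-c) Kq<Kc)

    span-below : QuantumSpan K′ c a → ∀ q → c < q → q < a → K c ℤ.< K q × K q ℤ.< K m
    span-below (_ , span) q c<q q<a with span q c<q q<a
    ... | Kc<Kq , Kq<Km =
      subst₂ ℤ._<_ K′-c (K′-below q q<a) Kc<Kq , subst₂ ℤ._<_ (K′-below q q<a) K′-a Kq<Km

    below-a-or-beyond-p : ∀ q → c < q → (q < a) ⊎ (p < q)
    below-a-or-beyond-p q c<q with FP.<-cmp q a
    ... | tri< q<a _ _ = inj₁ q<a
    ... | tri≈ _ refl _ = inj₂ p<a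
    ... | tri> _ _ a<q = inj₂ (<-trans p<a a<q)

    gap-forces-Kc<Kp : K p ≢ K c → BruhatGap K′ c a → K m ℤ.< K p → K c ℤ.< K p
    gap-forces-Kc<Kp Kp≢Kc gapY Km<Kp with ZP.<-cmp (K c) (K p)
    ... | tri< Kc<Kp _ _ = Kc<Kp
    ... | tri≈ _ Kc≡Kp _ = ⊥-elim (Kp≢Kc (sym Kc≡Kp))
    ... | tri> _ _ Kp<Kc = ⊥-elim (gap-below gapY p c<p p<a (Km<Kp , Kp<Kc))

  gap-compose : K p ≢ K c → BruhatGap K′ c a → BruhatGap K p m ⊎ QuantumSpan K p m → BruhatGap K c m
  gap-compose Kp≢Kc gapY coverP = subst₂ ℤ._<_ K′-a K′-c (proj₁ gapY) , gap
    where
    beyond-p : BruhatGap K p m ⊎ QuantumSpan K p m →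
               ∀ q → p < q → q < m → ¬ (K m ℤ.< K q × K q ℤ.< K c)
    beyond-p (inj₁ (Km<Kp , gapP)) q p<q q<m (Km<Kq , Kq<Kc) =
      gapP q p<q q<m (Km<Kq , ZP.<-trans Kq<Kc (gap-forces-Kc<Kp Kp≢Kc gapY Km<Kp))
    beyond-p (inj₂ (_ , spanP)) q p<q q<m (Km<Kq , _) = ZP.<-asym Km<Kq (proj₂ (spanP q p<q q<m))
    gap : ∀ q → c < q → q < m → ¬ (K m ℤ.< K q × K q ℤ.< K c)
    gap q c<q q<m with below-a-or-beyond-p q c<q
    ... | inj₁ q<a = gap-below gapY q c<q q<a
    ... | inj₂ p<q = beyond-p coverP q p<q q<m

  span-excludes-gap : QuantumSpan K′ c a → ¬ BruhatGap K p m
  span-excludes-gap spanY (Km<Kp , _) = ZP.<-asym Km<Kp (proj₂ (span-below spanY p c<p p<a))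

  span-compose : QuantumSpan K′ c a → QuantumSpan K p m → QuantumSpan K c m
  span-compose spanY (_ , spanP) = subst₂ ℤ._<_ K′-c K′-a (proj₁ spanY) , span
    where
    Kc<Kp : K c ℤ.< K p
    Kc<Kp = proj₁ (span-below spanY p c<p p<a)
    span : ∀ q → c < q → q < m → K c ℤ.< K q × K q ℤ.< K m
    span q c<q q<m with below-a-or-beyond-p q c<q
    ... | inj₁ q<a = span-below spanY q c<q q<a
    ... | inj₂ p<q = let Kp<Kq , Kq<Km = spanP q p<q q<m in ZP.<-trans Kc<Kp Kp<Kq , Kq<Km

  gapOrSpan-compose : K p ≢ K c → BruhatGap K′ c a ⊎ QuantumSpan K′ c a →
                      BruhatGap K p m ⊎ QuantumSpan K p m → BruhatGap K c m ⊎ QuantumSpan K c m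
  gapOrSpan-compose Kp≢Kc (inj₁ gapY)  coverP       = inj₁ (gap-compose Kp≢Kc gapY coverP)
  gapOrSpan-compose Kp≢Kc (inj₂ spanY) (inj₁ gapP)  = ⊥-elim (span-excludes-gap spanY gapP)
  gapOrSpan-compose Kp≢Kc (inj₂ spanY) (inj₂ spanP) = inj₂ (span-compose spanY spanP)

lemma6p4 : ∀ {n} (w : W n) (m : Fin n) (s : ℕ) (a : Fin (suc s) → Fin n)
    → (a-incr : ∀ t u → t < u → a t < a u)
    → (a<m : ∀ t → a t < m)
    → (a-edge : ∀ t → QBGEdge w (⦅ a t , m ⦆ (a<m t)))
    → (c : Fin n) (c<a₁ : c < a zero)
    → QBGEdge (w ⋆ map (λ t → ⦅ a t , m ⦆ (a<m t)) (allFin (suc s)))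
              (⦅ c , a zero ⦆ c<a₁)
    → ¬ QBGEdge w (⦅ c , m ⦆ (<-trans c<a₁ (a<m zero)))
    → ∀ (p : Fin n) (p<a₁ : p < a zero)
    → QBGEdge w (⦅ p , m ⦆ (<-trans p<a₁ (a<m zero)))
    → p < c
lemma6p4 w m s a a-incr a<m _ c c<a₁ edgeY no-edge-c p p<a₁ edgeP with FP.<-cmp p c
... | tri< p<c _ _ = p<c
... | tri≈ _ refl _ = ⊥-elim (no-edge-c (gapOrSpan⇒edge w c<m (edge⇒gapOrSpan w p<m edgeP)))
  where
  c<m = <-trans c<a₁ (a<m zero)
  p<m = <-trans p<a₁ (a<m zero)
... | tri> _ _ c<p = ⊥-elim (no-edge-c (gapOrSpan⇒edge w c<m
        (gapOrSpan-compose (window w) (window path) c<p p<a₁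
           (window-path-below w a a-incr a<m) (window-path-start w a a-incr a<m)
           (window-injective w (λ p≡c → FP.<-irrefl (sym p≡c) c<p))
           (edge⇒gapOrSpan path c<a₁ edgeY) (edge⇒gapOrSpan w p<m edgeP))))
  where
  path = w ⋆ map (λ t → ⦅ a t , m ⦆ (a<m t)) (allFin (suc s))
  c<m = <-trans c<a₁ (a<m zero)
  p<m = <-trans p<a₁ (a<m zero)
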